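{- Let $c:\mathbb{N}\to\mathbb{R}$ be weakly decreasing, and let $\mathbf{r}=(r_0,r_1,r_2,\ldots)$ be a sequence of integers with $r_0\mid r_1\mid r_2\mid\cdots$. For $x\in\mathbb{Z}$ let $v_{\mathbf{r}}(x)=\max\{i\in\mathbb{N}: r_i\mid x\}$ when this maximum exists. Let $E\subseteq\mathbb{Z}$ be such that $v_{\mathbf{r}}(a-b)$ is defined for all distinct $a,b\in E$, and define $d(a,b)=c(v_{\mathbf{r}}(a-b))$ for distinct $a,b\in E$ and $w(e)=0$ for all $e\in E$. Let $m$ be a nonnegative integer and assume $1,2,\ldots,m\in E$. Then $(1,2,\ldots,m)$ is a greedy $m$-permutation of $E$ with respect to $(E,w,d)$.
   Context: Here $\mathbb{N}=\{0,1,2,\ldots\}$. The triple $(E,w,d)$ is an ultra triple, i.e. $d$ is symmetric and $d(a,b)\le\max\{d(a,c),d(b,c)\}$ for distinct $a,b,c$. For finite $A\subseteq E$, $\operatorname{PER}(A)=\sum_{a\in A}w(a)+\sum d(a,b)$, the second sum over unordered pairs $\{a,b\}\subseteq A$ with $a\ne b$. A greedy $m$-permutation of $C\subseteq E$ is a list $(c_1,\ldots,c_m)$ of $m$ distinct elements of $C$ such that for each $i\in\{1,\ldots,m\}$ and each $x\in C\setminus\{c_1,\ldots,c_{i-1}\}$, $\operatorname{PER}\{c_1,\ldots,c_i\}\ge\operatorname{PER}\{c_1,\ldots,c_{i-1},x\}$. -}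

module Defs where

open import Data.Nat using (ℕ; zero; suc; _∸_; _≤_)
open import Data.Integer using (ℤ)
open import Data.Integer.Divisibility using (_∣_)
open import Data.List using (List; []; _∷_; foldr; take; _++_; [_]; length)
open import Data.List.Relation.Unary.All using (All)
open import Data.List.Relation.Unary.Unique.Propositional using (Unique)
open import Data.List.Membership.Propositional using (_∉_)
open import Data.Product using (_×_)
open import Relation.Binary.PropositionalEquality using (_≡_)
open import Level using (Level)

IsMaxDiv : (r : ℕ → ℤ) (x : ℤ) (i : ℕ) → Set
IsMaxDiv r x i = (r i ∣ x) × (∀ j → r j ∣ x → j ≤ i)

module _ {a ℓ : Level} {A : Set a}
         (_≼_ : A → A → Set ℓ) (_+_ : A → A → A) (0# : A)
         (w : ℤ → A) (d : ℤ → ℤ → A) where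

  sumD : ℤ → List ℤ → A
  sumD x bs = foldr (λ b acc → d x b + acc) 0# bs

  -- PER of the (finite, duplicate-free) set listed by the list:
  -- sum of weights plus sum of d over unordered pairs of distinct entries
  PER : List ℤ → A
  PER []       = 0#
  PER (x ∷ xs) = w x + (sumD x xs + PER xs)

  IsGreedyPerm : (C : ℤ → Set) → List ℤ → ℕ → Set ℓ
  IsGreedyPerm C cs m =
    (length cs ≡ m) × Unique cs × All C cs ×
    (∀ i → 1 ≤ i → i ≤ m → ∀ x → C x → x ∉ take (i ∸ 1) cs →
       PER (take (i ∸ 1) cs ++ [ x ]) ≼ PER (take i cs))

module Submission where

open import Defs
open import Level using (Level)
open import Algebra.Bundles using (AbelianGroup)
open import Relation.Binary.Structures using (IsTotalOrder)
open import Data.Nat using (ℕ; suc; _≤_)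
open import Data.Integer using (ℤ; +_; _-_)
open import Data.Integer.Divisibility using (_∣_)
open import Data.List using (map; upTo)
open import Relation.Binary.PropositionalEquality using (_≢_)

open import Function using (_∘_)
open import Data.Bool using (Bool; true; false)
open import Data.Nat using (zero; _+_; _∸_; _<_; z≤n; s≤s; _≤?_)
open import Data.Nat.Properties using (m∸n+n≡m; <⇒≤; <-irrefl; ≤-trans; ≤-refl)
open import Data.Integer using (∣_∣)
open import Data.List using (List; []; _∷_; foldr; applyUpTo; take; _++_; [_])
open import Data.List.Properties using (map-upTo; applyUpTo-∷ʳ; length-applyUpTo)
open import Data.List.Membership.Propositional using (_∉_)
open import Data.List.Membership.Propositional.Properties using (∈-applyUpTo⁺)
open import Data.List.Relation.Unary.All.Properties using (applyUpTo⁺₁)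
open import Data.List.Relation.Unary.Unique.Propositional.Properties
  using () renaming (applyUpTo⁺₁ to unique-applyUpTo⁺₁)
open import Data.Product using (_,_)
open import Function.Bundles using (mk⇔)
open import Relation.Nullary using (does)
open import Relation.Nullary.Decidable using (does-⇔)
open import Relation.Binary.PropositionalEquality as ≡ using (_≡_)
import Data.Nat.Divisibility as ℕ

-- Write [1..n] for the list 1, …, n and put d(a,b) = c(v(a − b)), w = 0.  As
-- PER([1..n] ++ [x]) = PER[1..n] + Σ_{b ≤ n} d(b,x), the greedy condition at
-- step n+1 amounts to  Σ_{b ≤ n} c(v(b − x)) ≤ Σ_{b ≤ n} c(v(b − (n+1)))  for
-- every x ∈ E outside [1..n].

module Counting where

  open import Data.Nat using (_⊔_)
  open import Data.Nat.Properties using (+-assoc; m≤n+m; m≤m⊔n; m≤n⊔m)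
  open ≡ using (refl; cong; cong₂; trans; sym)

  indicator : Bool → ℕ
  indicator true  = 1
  indicator false = 0

  count : (ℕ → Bool) → ℕ → ℕ
  count q zero    = 0
  count q (suc n) = indicator (q 0) + count (q ∘ suc) n

  count-+ : ∀ q k l → count q (k + l) ≡ count q k + count (λ j → q (k + j)) l
  count-+ q zero    l = refl
  count-+ q (suc k) l = trans (cong (λ rest → indicator (q 0) + rest) (count-+ (q ∘ suc) k l))
                              (sym (+-assoc (indicator (q 0)) _ _))

  count-cong : ∀ q q' n → (∀ {j} → j < n → q j ≡ q' j) → count q n ≡ count q' n
  count-cong q q' zero    eq = refl
  count-cong q q' (suc n) eq =
    cong₂ _+_ (cong indicator (eq (s≤s z≤n))) (count-cong (q ∘ suc) (q' ∘ suc) n (eq ∘ s≤s))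

  count-none : ∀ q n → (∀ {j} → j < n → q j ≡ false) → count q n ≡ 0
  count-none q zero    none = refl
  count-none q (suc n) none rewrite none (s≤s z≤n) = count-none (q ∘ suc) n (none ∘ s≤s)

  count-some : ∀ q n {j} → j < n → q j ≡ true → 1 ≤ count q n
  count-some q (suc n) {zero}  _         qj rewrite qj = s≤s z≤n
  count-some q (suc n) {suc j} (s≤s j<n) qj =
    ≤-trans (count-some (q ∘ suc) n j<n qj) (m≤n+m _ (indicator (q 0)))

  maxBelow : (ℕ → ℕ) → ℕ → ℕ
  maxBelow h zero    = 0
  maxBelow h (suc n) = h 0 ⊔ maxBelow (h ∘ suc) n

  ≤-maxBelow : ∀ h n {j} → j < n → h j ≤ maxBelow h n
  ≤-maxBelow h (suc n) {zero}  _         = m≤m⊔n (h 0) _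
  ≤-maxBelow h (suc n) {suc j} (s≤s j<n) = ≤-trans (≤-maxBelow (h ∘ suc) n j<n) (m≤n⊔m (h 0) _)

-- Residue classes inside the segment 1, …, n.
module ResidueClasses where

  open Counting
  open import Data.Nat using (_*_; _<?_)
  open import Data.Nat.Properties
    using (+-comm; m≤m+n; m<m+n; ≤-<-trans; m∸n≤m; m<n⇒0<n∸m; +-∸-comm; [m+n]∸[m+o]≡n∸o;
           +-monoʳ-≤; +-monoˡ-≤; ≤-reflexive; ≮⇒≥; <⇒≱; 0≢1+n; module ≤-Reasoning)
  open import Data.Nat.Divisibility using (_∣?_; n∣m*n; ∣-refl; ∣m∣n⇒∣m+n; ∣m+n∣m⇒∣n; 0∣⇒≡0; ∣⇒≤)
  open import Data.Nat.Induction using (<-rec)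
  import Data.Integer as ℤ
  import Data.Integer.Properties as ℤ
  import Data.Integer.DivMod as ℤ
  open import Data.Integer.Tactic.RingSolver using (solve-∀)
  open import Data.Empty using (⊥)
  open import Data.Product using (∃; _×_)
  open import Data.Sum using (_⊎_; inj₁; inj₂; map₂)
  open import Relation.Nullary using (yes; no)
  open import Relation.Nullary.Decidable using (dec-true; dec-false)
  open ≡ using (refl; subst; cong; cong₂; trans; sym; module ≡-Reasoning)

  dvd : ℕ → ℤ → Bool
  dvd p z = does (p ∣? ∣ z ∣)

  classCount : ℕ → ℤ → ℕ → ℕ
  classCount p y n = count (λ j → dvd p (+ suc j - y)) n

  dvd-top : ∀ p {j n} → j ≤ n → dvd p (+ suc j - + suc n) ≡ does (p ∣? (n ∸ j))
  dvd-top p {j} {n} j≤n =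
    cong (does ∘ (p ∣?_)) (trans (cong ∣_∣ (ℤ.m-n≡m⊖n (suc j) (suc n))) (ℤ.∣⊖∣-≤ (s≤s j≤n)))

  ∣?-periodic : ∀ p a → does (p ∣? (a + p)) ≡ does (p ∣? a)
  ∣?-periodic p a with p ∣? a
  ... | yes p∣a = dec-true (p ∣? (a + p)) (∣m∣n⇒∣m+n p∣a ∣-refl)
  ... | no  p∤a = dec-false (p ∣? (a + p))
                    (λ p∣a+p → p∤a (∣m+n∣m⇒∣n (subst (p ℕ.∣_) (+-comm a p) p∣a+p) ∣-refl))

  ∣?-small : ∀ p k → 0 < k → (p ≡ 0 ⊎ k < p) → does (p ∣? k) ≡ false
  ∣?-small p (suc k) _ small = dec-false (p ∣? suc k) (impossible small)
    where
    impossible : (p ≡ 0 ⊎ suc k < p) → p ℕ.∣ suc k → ⊥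
    impossible (inj₁ refl) 0∣k = 0≢1+n (sym (0∣⇒≡0 0∣k))
    impossible (inj₂ k<p)  p∣k = <⇒≱ k<p (∣⇒≤ p∣k)

  classCount-top-small : ∀ p n → (p ≡ 0 ⊎ n < p) → classCount p (+ suc n) n ≡ 0
  classCount-top-small p n small = count-none _ n λ {j} j<n →
    trans (dvd-top p (<⇒≤ j<n))
          (∣?-small p (n ∸ j) (m<n⇒0<n∸m j<n) (map₂ (≤-<-trans (m∸n≤m n j)) small))

  classCount-top-period : ∀ p' o →
    classCount (suc p') (+ suc (o + suc p')) (o + suc p') ≡ classCount (suc p') (+ suc o) o + 1
  classCount-top-period p' o = begin
    count Q (o + p)                          ≡⟨ count-+ Q o p ⟩
    count Q o + count (λ j → Q (o + j)) p    ≡⟨ cong₂ _+_ (count-cong Q _ o shift) lastPeriod ⟩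
    classCount p (+ suc o) o + 1             ∎
    where
    open ≡-Reasoning
    p = suc p'
    Q : ℕ → Bool
    Q j = dvd p (+ suc j - + suc (o + p))
    shift : ∀ {j} → j < o → Q j ≡ dvd p (+ suc j - + suc o)
    shift {j} j<o = begin
      Q j                          ≡⟨ dvd-top p (≤-trans (<⇒≤ j<o) (m≤m+n o p)) ⟩
      does (p ∣? ((o + p) ∸ j))    ≡⟨ cong (does ∘ (p ∣?_)) (+-∸-comm p (<⇒≤ j<o)) ⟩
      does (p ∣? ((o ∸ j) + p))    ≡⟨ ∣?-periodic p (o ∸ j) ⟩
      does (p ∣? (o ∸ j))          ≡⟨ dvd-top p (<⇒≤ j<o) ⟨
      dvd p (+ suc j - + suc o)    ∎
    firstHit : Q (o + 0) ≡ true
    firstHit = trans (dvd-top p (+-monoʳ-≤ o z≤n))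
                     (trans (cong (does ∘ (p ∣?_)) ([m+n]∸[m+o]≡n∸o o p 0)) (dec-true (p ∣? p) ∣-refl))
    laterMiss : ∀ {j} → j < p' → Q (o + suc j) ≡ false
    laterMiss {j} j<p' =
      trans (dvd-top p (+-monoʳ-≤ o (s≤s (<⇒≤ j<p'))))
            (trans (cong (does ∘ (p ∣?_)) ([m+n]∸[m+o]≡n∸o o p (suc j)))
                   (∣?-small p (p' ∸ j) (m<n⇒0<n∸m j<p') (inj₂ (s≤s (m∸n≤m p' j)))))
    lastPeriod : count (λ j → Q (o + j)) p ≡ 1
    lastPeriod rewrite firstHit = cong suc (count-none _ p' laterMiss)

  residue-in-block : ∀ p' y o → ∃ λ j → j < suc p' × dvd (suc p') (+ suc (o + j) - y) ≡ true
  residue-in-block p' y o =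
    j , ℤ.n%ℕd<d z p , dec-true (p ∣? _) (subst (p ℕ.∣_) (sym distance) (n∣m*n ∣ q ∣))
    where
    p = suc p'
    z = y - + suc o
    j = z ℤ.%ℕ p
    q = z ℤ./ℕ p
    rearrange : ∀ a i y → (a ℤ.+ i) - y ≡ ℤ.- ((y - a) - i)
    rearrange = solve-∀
    cancel : ∀ i k → (i ℤ.+ k) - i ≡ k
    cancel = solve-∀
    distance : ∣ + suc (o + j) - y ∣ ≡ ∣ q ∣ * p
    distance = begin
      ∣ + suc (o + j) - y ∣            ≡⟨ cong (λ t → ∣ t - y ∣) (ℤ.pos-+ (suc o) j) ⟩
      ∣ (+ suc o ℤ.+ + j) - y ∣        ≡⟨ cong ∣_∣ (rearrange (+ suc o) (+ j) y) ⟩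
      ∣ ℤ.- (z - + j) ∣                ≡⟨ ℤ.∣-i∣≡∣i∣ (z - + j) ⟩
      ∣ z - + j ∣                      ≡⟨ cong (λ t → ∣ t - + j ∣) (ℤ.a≡a%ℕn+[a/ℕn]*n z p) ⟩
      ∣ (+ j ℤ.+ q ℤ.* + p) - + j ∣    ≡⟨ cong ∣_∣ (cancel (+ j) (q ℤ.* + p)) ⟩
      ∣ q ℤ.* + p ∣                    ≡⟨ ℤ.abs-* q (+ p) ⟩
      ∣ q ∣ * p                        ∎
      where open ≡-Reasoning

  classCount-period : ∀ p' y o → classCount (suc p') y o + 1 ≤ classCount (suc p') y (o + suc p')
  classCount-period p' y o with residue-in-block p' y o
  ... | j , j<p , hit rewrite count-+ (λ j → dvd (suc p') (+ suc j - y)) o (suc p') =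
    +-monoʳ-≤ (classCount (suc p') y o) (count-some (λ k → dvd (suc p') (+ suc (o + k) - y)) (suc p') j<p hit)

  TopIsRarest : ℕ → ℤ → ℕ → Set
  TopIsRarest p y n = classCount p (+ suc n) n ≤ classCount p y n

  topIsRarest : ∀ p y n → TopIsRarest p y n
  topIsRarest zero     y n = ≤-trans (≤-reflexive (classCount-top-small 0 n (inj₁ refl))) z≤n
  topIsRarest (suc p') y   = <-rec (TopIsRarest p y) step
    where
    p = suc p'
    afterPeriod : ∀ o → TopIsRarest p y o → TopIsRarest p y (o + p)
    afterPeriod o ih = begin
      classCount p (+ suc (o + p)) (o + p)  ≡⟨ classCount-top-period p' o ⟩
      classCount p (+ suc o) o + 1          ≤⟨ +-monoˡ-≤ 1 ih ⟩
      classCount p y o + 1                  ≤⟨ classCount-period p' y o ⟩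
      classCount p y (o + p)                ∎
      where open ≤-Reasoning
    step : ∀ n → (∀ {k} → k < n → TopIsRarest p y k) → TopIsRarest p y n
    step n rec with n <? p
    ... | yes n<p = ≤-trans (≤-reflexive (classCount-top-small p n (inj₂ n<p))) z≤n
    ... | no  n≮p = subst (TopIsRarest p y) o+p≡n (afterPeriod o (rec o<n))
      where
      o = n ∸ p
      o+p≡n : o + p ≡ n
      o+p≡n = m∸n+n≡m (≮⇒≥ n≮p)
      o<n : o < n
      o<n = subst (o <_) o+p≡n (m<m+n o (s≤s z≤n))

module OrderedAbelianGroup {g ℓ₁ ℓ₂ : Level} (G : AbelianGroup g ℓ₁)
  (_≼_ : AbelianGroup.Carrier G → AbelianGroup.Carrier G → Set ℓ₂)
  (≼-isTotalOrder : IsTotalOrder (AbelianGroup._≈_ G) _≼_)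
  (∙-monoˡ : ∀ x y z → x ≼ y → AbelianGroup._∙_ G x z ≼ AbelianGroup._∙_ G y z) where

  open Counting
  open import Data.Nat using (_⊓_; _⊔_)
  open import Data.Nat.Properties using (n≤1+n; m≤n⇒m≤1+n; m≤n⇒m⊓n≡m; m≥n⇒m⊓n≡n; ≰⇒>; ≤-pred; m≤m⊔n; m≤n⊔m; ⊓-zeroʳ)
  open import Relation.Binary.Bundles using (Preorder)
  open import Relation.Nullary using (Dec; yes; no)
  open AbelianGroup G
  open import Algebra.Definitions.RawMonoid rawMonoid using (_×_)
  open import Algebra.Properties.AbelianGroup G using (xyx⁻¹≈y)
  open import Algebra.Solver.CommutativeMonoid commutativeMonoid using (solve; _⊕_; _⊜_; id)

  ≼-preorder : Preorder g ℓ₁ ℓ₂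
  ≼-preorder = record { isPreorder = IsTotalOrder.isPreorder ≼-isTotalOrder }

  open Preorder ≼-preorder public using () renaming (refl to ≼-refl)
  open import Relation.Binary.Reasoning.Preorder ≼-preorder

  ∙-mono : ∀ {a a' b b'} → a ≼ a' → b ≼ b' → (a ∙ b) ≼ (a' ∙ b')
  ∙-mono {a} {a'} {b} {b'} a≼a' b≼b' = begin
    a ∙ b    ≲⟨ ∙-monoˡ a a' b a≼a' ⟩
    a' ∙ b   ≈⟨ comm a' b ⟩
    b ∙ a'   ≲⟨ ∙-monoˡ b b' a' b≼b' ⟩
    b' ∙ a'  ≈⟨ comm b' a' ⟩
    a' ∙ b'  ∎

  sum : (ℕ → Carrier) → ℕ → Carrier
  sum g zero    = ε
  sum g (suc n) = g 0 ∙ sum (g ∘ suc) n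

  sum-cong : ∀ g h n → (∀ {j} → j < n → g j ≈ h j) → sum g n ≈ sum h n
  sum-cong g h zero    eq = refl
  sum-cong g h (suc n) eq = ∙-cong (eq (s≤s z≤n)) (sum-cong (g ∘ suc) (h ∘ suc) n (eq ∘ s≤s))

  sum-∙ : ∀ g h n → sum (λ j → g j ∙ h j) n ≈ sum g n ∙ sum h n
  sum-∙ g h zero    = sym (identityˡ ε)
  sum-∙ g h (suc n) = begin-equality
    (g 0 ∙ h 0) ∙ sum (λ j → g (suc j) ∙ h (suc j)) n   ≈⟨ ∙-congˡ (sum-∙ (g ∘ suc) (h ∘ suc) n) ⟩
    (g 0 ∙ h 0) ∙ (sum (g ∘ suc) n ∙ sum (h ∘ suc) n)  ≈⟨ interchange (g 0) (h 0) _ _ ⟩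
    (g 0 ∙ sum (g ∘ suc) n) ∙ (h 0 ∙ sum (h ∘ suc) n)  ∎
    where
    interchange : ∀ a b c d → (a ∙ b) ∙ (c ∙ d) ≈ (a ∙ c) ∙ (b ∙ d)
    interchange = solve 4 (λ a b c d → (a ⊕ b) ⊕ (c ⊕ d) ⊜ (a ⊕ c) ⊕ (b ⊕ d)) refl

  when : Bool → Carrier → Carrier
  when true  x = x
  when false x = ε

  sum-when : ∀ q x n → sum (λ j → when (q j) x) n ≈ count q n × x
  sum-when q x zero = refl
  sum-when q x (suc n) with q 0
  ... | true  = ∙-congˡ (sum-when (q ∘ suc) x n)
  ... | false = trans (identityˡ _) (sum-when (q ∘ suc) x n)

  ×-antitone : ∀ {x} → x ≼ ε → ∀ {m n} → n ≤ m → (m × x) ≼ (n × x)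
  ×-antitone {x} x≼ε {m} z≤n = ×≼ε m
    where
    ×≼ε : ∀ m → (m × x) ≼ ε
    ×≼ε zero    = ≼-refl
    ×≼ε (suc m) = begin
      x ∙ m × x  ≲⟨ ∙-mono x≼ε (×≼ε m) ⟩
      ε ∙ ε      ≈⟨ identityˡ ε ⟩
      ε          ∎
  ×-antitone x≼ε (s≤s n≤m) = ∙-mono ≼-refl (×-antitone x≼ε n≤m)

  -- The layer-cake comparison for an antitone c : ℕ → Carrier.
  module LayerCake (c : ℕ → Carrier) (c-anti : ∀ i j → i ≤ j → c j ≼ c i) where

    δ : ℕ → Carrier
    δ T = c (suc T) ∙ c T ⁻¹

    δ≼ε : ∀ T → δ T ≼ ε
    δ≼ε T = begin
      c (suc T) ∙ c T ⁻¹  ≲⟨ ∙-monoˡ _ _ (c T ⁻¹) (c-anti T (suc T) (n≤1+n T)) ⟩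
      c T ∙ c T ⁻¹        ≈⟨ inverseʳ (c T) ⟩
      ε                   ∎

    c-⊓-suc : ∀ k T (T<k? : Dec (suc T ≤ k)) → c (k ⊓ suc T) ≈ c (k ⊓ T) ∙ when (does T<k?) (δ T)
    c-⊓-suc k T (yes T<k) rewrite m≥n⇒m⊓n≡n T<k | m≥n⇒m⊓n≡n (<⇒≤ T<k) = begin-equality
      c (suc T)                      ≈⟨ xyx⁻¹≈y (c T) (c (suc T)) ⟨
      c T ∙ c (suc T) ∙ c T ⁻¹       ≈⟨ assoc (c T) (c (suc T)) (c T ⁻¹) ⟩
      c T ∙ (c (suc T) ∙ c T ⁻¹)     ∎
    c-⊓-suc k T (no  T≮k) with k≤T ← ≤-pred (≰⇒> T≮k)
      rewrite m≤n⇒m⊓n≡m (m≤n⇒m≤1+n k≤T) | m≤n⇒m⊓n≡m k≤T = sym (identityʳ (c k))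

    sum-⊓-suc : ∀ (h : ℕ → ℕ) n T → sum (λ j → c (h j ⊓ suc T)) n
                                  ≈ sum (λ j → c (h j ⊓ T)) n ∙ count (λ j → does (suc T ≤? h j)) n × δ T
    sum-⊓-suc h n T = begin-equality
      sum (λ j → c (h j ⊓ suc T)) n
        ≈⟨ sum-cong (λ j → c (h j ⊓ suc T)) (λ j → c (h j ⊓ T) ∙ when (does (suc T ≤? h j)) (δ T)) n
                    (λ {j} _ → c-⊓-suc (h j) T (suc T ≤? h j)) ⟩
      sum (λ j → c (h j ⊓ T) ∙ when (does (suc T ≤? h j)) (δ T)) n
        ≈⟨ sum-∙ (λ j → c (h j ⊓ T)) (λ j → when (does (suc T ≤? h j)) (δ T)) n ⟩
      sum (λ j → c (h j ⊓ T)) n ∙ sum (λ j → when (does (suc T ≤? h j)) (δ T)) n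
        ≈⟨ ∙-congˡ (sum-when (λ j → does (suc T ≤? h j)) (δ T) n) ⟩
      sum (λ j → c (h j ⊓ T)) n ∙ count (λ j → does (suc T ≤? h j)) n × δ T
        ∎

    -- If for every level t fewer j < n have u j ≥ t than f j ≥ t, then Σ c ∘ f ≤ Σ c ∘ u.
    -- Induction on a truncation level T, which is then taken above all values.
    layerCake : ∀ (f u : ℕ → ℕ) n →
                (∀ t → count (λ j → does (t ≤? u j)) n ≤ count (λ j → does (t ≤? f j)) n) →
                sum (c ∘ f) n ≼ sum (c ∘ u) n
    layerCake f u n fewer = begin
      sum (c ∘ f) n                ≈⟨ sum-cong _ _ n (untruncate f (λ j<n → ≤-trans (m≤m⊔n _ _) (bound j<n))) ⟩
      sum (λ j → c (f j ⊓ M)) n    ≲⟨ truncated M ⟩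
      sum (λ j → c (u j ⊓ M)) n    ≈⟨ sum-cong _ _ n (untruncate u (λ j<n → ≤-trans (m≤n⊔m _ _) (bound j<n))) ⟨
      sum (c ∘ u) n                ∎
      where
      M = maxBelow (λ j → f j ⊔ u j) n
      bound : ∀ {j} → j < n → f j ⊔ u j ≤ M
      bound = ≤-maxBelow (λ j → f j ⊔ u j) n
      untruncate : ∀ h → (∀ {j} → j < n → h j ≤ M) → ∀ {j} → j < n → c (h j) ≈ c (h j ⊓ M)
      untruncate h h≤M j<n = reflexive (≡.cong c (≡.sym (m≤n⇒m⊓n≡m (h≤M j<n))))
      truncated : ∀ T → sum (λ j → c (f j ⊓ T)) n ≼ sum (λ j → c (u j ⊓ T)) n
      truncated zero = begin
        sum (λ j → c (f j ⊓ 0)) n  ≈⟨ sum-cong _ _ n (λ {j} _ → reflexive (≡.cong c (⊓-zeroʳ (f j)))) ⟩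
        sum (λ _ → c 0) n          ≈⟨ sum-cong _ _ n (λ {j} _ → reflexive (≡.cong c (⊓-zeroʳ (u j)))) ⟨
        sum (λ j → c (u j ⊓ 0)) n  ∎
      truncated (suc T) = begin
        sum (λ j → c (f j ⊓ suc T)) n
          ≈⟨ sum-⊓-suc f n T ⟩
        sum (λ j → c (f j ⊓ T)) n ∙ count (λ j → does (suc T ≤? f j)) n × δ T
          ≲⟨ ∙-mono (truncated T) (×-antitone (δ≼ε T) (fewer (suc T))) ⟩
        sum (λ j → c (u j ⊓ T)) n ∙ count (λ j → does (suc T ≤? u j)) n × δ T
          ≈⟨ sum-⊓-suc u n T ⟨
        sum (λ j → c (u j ⊓ suc T)) n
          ∎

  listSum : (ℤ → Carrier) → List ℤ → Carrier
  listSum g = foldr (λ b acc → g b ∙ acc) ε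

  listSum-snoc : ∀ g L x → listSum g (L ++ [ x ]) ≈ listSum g L ∙ g x
  listSum-snoc g [] x = trans (identityʳ (g x)) (sym (identityˡ (g x)))
  listSum-snoc g (b ∷ L) x = trans (∙-congˡ (listSum-snoc g L x)) (sym (assoc (g b) _ (g x)))

  listSum-applyUpTo : ∀ g (h : ℕ → ℤ) n → listSum g (applyUpTo h n) ≡ sum (g ∘ h) n
  listSum-applyUpTo g h zero    = ≡.refl
  listSum-applyUpTo g h (suc n) = ≡.cong (g (h 0) ∙_) (listSum-applyUpTo g (h ∘ suc) n)

  PER-snoc : ∀ d L x → PER _≼_ _∙_ ε (λ _ → ε) d (L ++ [ x ])
                       ≈ PER _≼_ _∙_ ε (λ _ → ε) d L ∙ listSum (λ b → d b x) L
  PER-snoc d [] x = ∙-congˡ (identityˡ ε)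
  PER-snoc d (b ∷ L) x = begin-equality
    ε ∙ (listSum (d b) (L ++ [ x ]) ∙ PER′ (L ++ [ x ]))
      ≈⟨ ∙-congˡ (∙-cong (listSum-snoc (d b) L x) (PER-snoc d L x)) ⟩
    ε ∙ ((listSum (d b) L ∙ d b x) ∙ (PER′ L ∙ listSum (λ a → d a x) L))
      ≈⟨ regroup (listSum (d b) L) (d b x) (PER′ L) (listSum (λ a → d a x) L) ⟩
    (ε ∙ (listSum (d b) L ∙ PER′ L)) ∙ (d b x ∙ listSum (λ a → d a x) L)
      ∎
    where
    PER′ = PER _≼_ _∙_ ε (λ _ → ε) d
    regroup : ∀ s e p t → ε ∙ ((s ∙ e) ∙ (p ∙ t)) ≈ (ε ∙ (s ∙ p)) ∙ (e ∙ t)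
    regroup = solve 4 (λ s e p t → id ⊕ ((s ⊕ e) ⊕ (p ⊕ t)) ⊜ (id ⊕ (s ⊕ p)) ⊕ (e ⊕ t)) refl

open ≡ using (refl; subst; subst₂)

-- Valuations along a divisor chain r₀ ∣ r₁ ∣ r₂ ∣ ⋯.
module DivisorChain (r : ℕ → ℤ) (r-step : ∀ i → r i ∣ r (suc i)) where

  r-mono : ∀ {t s} → t ≤ s → r t ∣ r s
  r-mono {t} {s} t≤s = subst (λ k → r t ∣ r k) (m∸n+n≡m t≤s) (chain (s ∸ t))
    where
    chain : ∀ e → r t ∣ r (e + t)
    chain zero    = ℕ.∣-refl
    chain (suc e) = ℕ.∣-trans (chain e) (r-step (e + t))

  maxDiv-test : ∀ z {i} → IsMaxDiv r z i → ∀ t → does (t ≤? i) ≡ does (∣ r t ∣ ℕ.∣? ∣ z ∣)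
  maxDiv-test z {i} (r-i∣z , maximal) t =
    does-⇔ (mk⇔ (λ t≤i → ℕ.∣-trans (r-mono t≤i) r-i∣z) (maximal t)) (t ≤? i) (∣ r t ∣ ℕ.∣? ∣ z ∣)

take-applyUpTo : ∀ {a} {A : Set a} (h : ℕ → A) {n m} → n ≤ m → take n (applyUpTo h m) ≡ applyUpTo h n
take-applyUpTo h {zero}  _         = refl
take-applyUpTo h {suc n} (s≤s n≤m) = ≡.cong (h 0 ∷_) (take-applyUpTo (h ∘ suc) n≤m)

segment : ℕ → List ℤ
segment = applyUpTo (λ k → + suc k)

segment-distinct : ∀ {i j} → i < j → + suc i ≢ + suc j
segment-distinct i<j refl = <-irrefl refl i<j

module GreedySegment {g ℓ₁ ℓ₂ : Level} (G : AbelianGroup g ℓ₁)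
  (_≼_ : AbelianGroup.Carrier G → AbelianGroup.Carrier G → Set ℓ₂)
  (≼-isTotalOrder : IsTotalOrder (AbelianGroup._≈_ G) _≼_)
  (∙-monoˡ : ∀ x y z → x ≼ y → AbelianGroup._∙_ G x z ≼ AbelianGroup._∙_ G y z)
  (c : ℕ → AbelianGroup.Carrier G) (c-anti : ∀ i j → i ≤ j → c j ≼ c i)
  (r : ℕ → ℤ) (r-step : ∀ i → r i ∣ r (suc i))
  (E : ℤ → Set) (v : ℤ → ℕ)
  (v-max : ∀ a b → E a → E b → a ≢ b → IsMaxDiv r (a - b) (v (a - b))) where

  open Counting using (count; count-cong)
  open ResidueClasses using (classCount; topIsRarest)
  open AbelianGroup G using (Carrier; _∙_; ε)
  open OrderedAbelianGroup G _≼_ ≼-isTotalOrder ∙-monoˡ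
  open LayerCake c c-anti
  open DivisorChain r r-step
  open import Relation.Binary.Reasoning.Preorder ≼-preorder

  d : ℤ → ℤ → Carrier
  d a b = c (v (a - b))

  PERd : List ℤ → Carrier
  PERd = PER _≼_ _∙_ ε (λ _ → ε) d

  module _ (n : ℕ) (x : ℤ) (segment-in-E : ∀ {j} → j ≤ n → E (+ suc j)) (x∈E : E x) (x∉ : x ∉ segment n) where

    -- Counting the members of [1..n] within level t of y is counting a residue class mod ∣r t∣.
    levelCount≡classCount : ∀ t y → E y → (∀ {j} → j < n → + suc j ≢ y) →
      count (λ j → does (t ≤? v (+ suc j - y))) n ≡ classCount ∣ r t ∣ y n
    levelCount≡classCount t y y∈E y-new = count-cong _ _ n λ {j} j<n →
      maxDiv-test (+ suc j - y) (v-max (+ suc j) y (segment-in-E (<⇒≤ j<n)) y∈E (y-new j<n)) t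

    -- Hence, level by level, [1..n] is at most as close to n+1 as to x …
    levelCounts : ∀ t → count (λ j → does (t ≤? v (+ suc j - + suc n))) n
                      ≤ count (λ j → does (t ≤? v (+ suc j - x))) n
    levelCounts t = subst₂ _≤_
      (≡.sym (levelCount≡classCount t (+ suc n) (segment-in-E ≤-refl) segment-distinct))
      (≡.sym (levelCount≡classCount t x x∈E x-new))
      (topIsRarest ∣ r t ∣ x n)
      where
      x-new : ∀ {j} → j < n → + suc j ≢ x
      x-new j<n refl = x∉ (∈-applyUpTo⁺ (λ k → + suc k) j<n)

    -- … so x is at least as far from [1..n] as n+1 is (layer cake) …
    distanceSum-bound : sum (λ j → d (+ suc j) x) n ≼ sum (λ j → d (+ suc j) (+ suc n)) n
    distanceSum-bound = layerCake (λ j → v (+ suc j - x)) (λ j → v (+ suc j - + suc n)) n levelCounts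

    -- … which is the greedy inequality, as both sides extend PER[1..n].
    greedyStep : PERd (segment n ++ [ x ]) ≼ PERd (segment (suc n))
    greedyStep = begin
      PERd (segment n ++ [ x ])                                     ≈⟨ PER-snoc d (segment n) x ⟩
      PERd (segment n) ∙ listSum (λ b → d b x) (segment n)          ≡⟨ ≡.cong (PERd (segment n) ∙_) (listSum-applyUpTo _ _ n) ⟩
      PERd (segment n) ∙ sum (λ j → d (+ suc j) x) n                ≲⟨ ∙-mono ≼-refl distanceSum-bound ⟩
      PERd (segment n) ∙ sum (λ j → d (+ suc j) (+ suc n)) n        ≡⟨ ≡.cong (PERd (segment n) ∙_) (listSum-applyUpTo _ _ n) ⟨
      PERd (segment n) ∙ listSum (λ b → d b (+ suc n)) (segment n)  ≈⟨ PER-snoc d (segment n) (+ suc n) ⟨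
      PERd (segment n ++ [ + suc n ])                               ≡⟨ ≡.cong PERd (applyUpTo-∷ʳ _ n) ⟩
      PERd (segment (suc n))                                        ∎

proposition10p3 : ∀ {g ℓ₁ ℓ₂ : Level} (G : AbelianGroup g ℓ₁) →
    (_≼_ : AbelianGroup.Carrier G → AbelianGroup.Carrier G → Set ℓ₂) → IsTotalOrder (AbelianGroup._≈_ G) _≼_ →
    (∀ x y z → x ≼ y → AbelianGroup._∙_ G x z ≼ AbelianGroup._∙_ G y z) →
    (c : ℕ → AbelianGroup.Carrier G) → (∀ i j → i ≤ j → c j ≼ c i) →
    (r : ℕ → ℤ) → (∀ i → r i ∣ r (suc i)) →
    (E : ℤ → Set) →
    (v : ℤ → ℕ) →
    (∀ a b → E a → E b → a ≢ b → IsMaxDiv r (a - b) (v (a - b))) →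
    (m : ℕ) → (∀ k → 1 ≤ k → k ≤ m → E (+ k)) →
    IsGreedyPerm _≼_ (AbelianGroup._∙_ G) (AbelianGroup.ε G) (λ _ → AbelianGroup.ε G) (λ a b → c (v (a - b))) E
      (map (λ k → + suc k) (upTo m)) m
proposition10p3 G _≼_ ≼-tot ∙-monoˡ c c-anti r r-step E v v-max m initial∈E =
  subst (λ cs → IsGreedyPerm _≼_ _∙_ ε (λ _ → ε) d E cs m) (≡.sym (map-upTo (λ k → + suc k) m))
    ( length-applyUpTo _ m
    , unique-applyUpTo⁺₁ _ m (λ i<j _ → segment-distinct i<j)
    , applyUpTo⁺₁ _ m (λ j<m → initial∈E _ (s≤s z≤n) j<m)
    , greedy )
  where
  open AbelianGroup G using (_∙_; ε)
  open GreedySegment G _≼_ ≼-tot ∙-monoˡ c c-anti r r-step E v v-max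
  greedy : ∀ i → 1 ≤ i → i ≤ m → ∀ x → E x → x ∉ take (i ∸ 1) (segment m) →
           PERd (take (i ∸ 1) (segment m) ++ [ x ]) ≼ PERd (take i (segment m))
  greedy (suc n) _ n<m x x∈E x∉
    rewrite take-applyUpTo (λ k → + suc k) (<⇒≤ n<m) | take-applyUpTo (λ k → + suc k) n<m =
    greedyStep n x (λ j≤n → initial∈E _ (s≤s z≤n) (≤-trans (s≤s j≤n) n<m)) x∈E x∉
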